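{- (i) For the molecular graph of propane, $\pi_2^*(C_3H_8)=4$ and $P_2^*(C_3H_8)=4$. (ii) For the molecular graph of (normal) butane, $\pi_2^*(C_4H_{10})=5$ and $P_2^*(C_4H_{10})=8$.
   Context: Molecular graphs have one vertex per atom and one edge per bond. For $n\ge2$, the graph of the straight-chain alkane $C_nH_{2n+2}$ is the tree whose carbon vertices $c_1,\dots,c_n$ form a path $c_1c_2\cdots c_n$, where $c_1$ and $c_n$ are each adjacent to three hydrogen leaves and each $c_i$ with $1<i<n$ is adjacent to two hydrogen leaves (so every carbon has degree 4). Propane is the case $n=3$, butane the case $n=4$. For a graph $G=(V,E)$, a pebbling configuration is a function $f:V\to\mathbb{N}\cup\{0\}$, of weight $w(f)=\sum_u f(u)$. A pebbling move removes two pebbles from a vertex $u$ and places one pebble on a vertex adjacent to $u$. $f$ is solvable if for every vertex $v$ some (possibly empty) sequence of pebbling moves from $f$ results in at least one pebble on $v$. $f$ is a $2$-restricted pebbling configuration (2RPC) if $f(u)\le2$ for all $u$. $\pi_2^*(G)$ is the minimum weight of a solvable 2RPC on $G$; a $2$-restricted optimal pebbling configuration is a solvable 2RPC of weight $\pi_2^*(G)$, and $P_2^*(G)$ is the number of distinct such configurations. -}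

module Defs where

open import Data.Nat using (ℕ; zero; suc; _+_; _*_; _∸_; _≤_; _<_; _/_; _<ᵇ_; _≤ᵇ_)
open import Data.Bool using (if_then_else_)
open import Data.Fin using (Fin; toℕ)
open import Data.Vec using (Vec; lookup; updateAt; toList)
open import Data.List using (List; length)
open import Data.Nat.ListAction using (sum)
open import Data.List.Membership.Propositional using (_∈_)
open import Data.List.Relation.Unary.Unique.Propositional using (Unique)
open import Data.Product using (Σ; ∃; ∃-syntax; _×_; _,_)
open import Data.Sum using (_⊎_)
open import Relation.Binary.PropositionalEquality using (_≡_)
open import Relation.Binary.Construct.Closure.ReflexiveTransitive using (Star)
open import Function.Bundles using (_⇔_)

record Graph : Set₁ where
  field
    N   : ℕ
    Adj : Fin N → Fin N → Set
open Graph public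

-- Molecular graph of the straight-chain alkane C_n H_{2n+2}, n ≥ 2.
-- Vertices are numbered 0 .. 3n+1:
--   0 .. n-1        : carbons c_1 .. c_n (path c_1 c_2 ... c_n)
--   n .. 3n+1       : hydrogens h_0 .. h_{2n+1}  (vertex n + k is h_k)
-- Hydrogen h_k is attached to carbon `owner n k`:
--   h_0,h_1,h_2 to c_1; h_{2n-1},h_{2n},h_{2n+1} to c_n;
--   and h_{3+2j}, h_{4+2j} to c_{j+2} for the inner carbons.

owner : ℕ → ℕ → ℕ
owner n k =
  if k <ᵇ 3 then 0
  else if (2 * n ∸ 1) ≤ᵇ k then n ∸ 1
  else suc ((k ∸ 3) / 2)

AlkEdge : ℕ → ℕ → ℕ → Set
AlkEdge n a b =
  (a < n × b < n × suc a ≡ b)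
  ⊎ (a < n × n ≤ b × owner n (b ∸ n) ≡ a)

alkane : ℕ → Graph
alkane n = record
  { N   = 3 * n + 2
  ; Adj = λ u v → AlkEdge n (toℕ u) (toℕ v) ⊎ AlkEdge n (toℕ v) (toℕ u)
  }

propane : Graph
propane = alkane 3

butane : Graph
butane = alkane 4

module _ (G : Graph) where

  Config : Set
  Config = Vec ℕ (N G)

  weight : Config → ℕ
  weight f = sum (toList f)

  Move : Config → Config → Set
  Move f g = Σ (Fin (N G)) λ u → Σ (Fin (N G)) λ v →
    Adj G u v × 2 ≤ lookup f u ×
    g ≡ updateAt (updateAt f u (λ x → x ∸ 2)) v suc

  Reach : Config → Config → Set
  Reach = Star Move

  Solvable : Config → Set
  Solvable f = (v : Fin (N G)) → ∃[ g ] (Reach f g × 1 ≤ lookup g v)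

  TwoRestricted : Config → Set
  TwoRestricted f = (u : Fin (N G)) → lookup f u ≤ 2

  SolvableTwoRPC : Config → Set
  SolvableTwoRPC f = TwoRestricted f × Solvable f

  IsPi2Star : ℕ → Set
  IsPi2Star k =
    (∃[ f ] (SolvableTwoRPC f × weight f ≡ k)) ×
    ((f : Config) → SolvableTwoRPC f → k ≤ weight f)

  OptimalWith : ℕ → Config → Set
  OptimalWith k f = SolvableTwoRPC f × weight f ≡ k

  IsPi2StarCount : ℕ → ℕ → Set
  IsPi2StarCount k m =
    IsPi2Star k ×
    ∃[ L ] (Unique L × length L ≡ m ×
            ((f : Config) → (f ∈ L) ⇔ OptimalWith k f))

-- For a fixed graph both claims are finite. Whether a configuration can put a pebble on a
-- vertex is decided by exhaustive search over move sequences, which terminates because every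
-- move lowers the weight by one; and the 2-restricted configurations of weight at most k are
-- finitely many vectors over {0,1,2}. So it suffices to list the optimal configurations, check
-- that each is solvable of weight k, and check that every solvable 2-restricted configuration
-- of weight at most k is on the list: this gives π₂* = k and P₂* = the length of the list.

module Submission where

open import Defs
open import Data.Nat using (ℕ; zero; suc; _+_; _∸_; _≤_; _<_; s≤s; _≤?_; _<?_; _≟_; _≤ᵇ_)
open import Data.Nat.Properties
  using (+-assoc; +-suc; +-cancelˡ-≡; m∸n+n≡m; ≤-pred; <⇒≤; ≤-reflexive; <-irrefl; ≮⇒≥; n<1+n;
         +-commutativeSemigroup; ≤ᵇ⇒≤; ≤⇒≤ᵇ)
open import Algebra.Properties.CommutativeSemigroup +-commutativeSemigroup using (x∙yz≈y∙xz)
open import Data.Nat.ListAction using (sum)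
open import Data.Fin using (Fin; zero; suc; toℕ)
open import Data.Fin.Properties using (all?)
open import Data.Vec using (Vec; []; _∷_; lookup; updateAt; toList)
open import Data.Vec.Properties using (≡-dec)
open import Data.Bool using (Bool; T; false; _∧_; _∨_)
open import Data.Bool.Properties using (T-∧; T-∨; T?)
open import Data.Bool.ListAction using (any; all)
open import Data.Unit using (tt)
open import Data.List using (List; []; _∷_; [_]; _++_; map; length; allFin)
open import Data.List.Membership.Propositional using (_∈_; lose)
open import Data.List.Membership.Propositional.Properties using (∈-map⁺; ∈-++⁺ˡ; ∈-++⁺ʳ; ∈-allFin)
open import Data.List.Relation.Unary.Any using (here; satisfied)
open import Data.List.Relation.Unary.Any.Properties using (any⁺; any⁻)
open import Data.List.Relation.Unary.All as All using (All)
open import Data.List.Relation.Unary.All.Properties using (all⁺)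
open import Data.List.Relation.Unary.Unique.Propositional using (Unique)
open import Data.List.Relation.Unary.Unique.DecPropositional using (unique?)
open import Data.Product using (_×_; _,_; proj₂; ∃-syntax)
open import Data.Sum using (_⊎_; inj₁; inj₂)
open import Function using (_∘_)
open import Function.Bundles using (_⇔_; mk⇔; Equivalence)
open import Relation.Binary.PropositionalEquality using (_≡_; refl; sym; trans; cong; subst; module ≡-Reasoning)
open import Relation.Binary.Construct.Closure.ReflexiveTransitive using (ε; _◅_)
open import Relation.Nullary using (Dec; isYes)
open import Relation.Nullary.Decidable using (map′; _×-dec_; _⊎-dec_; _→-dec_; from-yes; toWitness; fromWitness)

open ≡-Reasoning

sum-updateAt : ∀ {m} (f : Vec ℕ m) i (h : ℕ → ℕ) →
  lookup f i + sum (toList (updateAt f i h)) ≡ h (lookup f i) + sum (toList f)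
sum-updateAt (x ∷ xs) zero    h = x∙yz≈y∙xz x (h x) _
sum-updateAt (x ∷ xs) (suc i) h = begin
  lookup xs i + (x + sum (toList (updateAt xs i h))) ≡⟨ x∙yz≈y∙xz (lookup xs i) x _ ⟩
  x + (lookup xs i + sum (toList (updateAt xs i h))) ≡⟨ cong (x +_) (sum-updateAt xs i h) ⟩
  x + (h (lookup xs i) + sum (toList xs))            ≡⟨ x∙yz≈y∙xz x (h (lookup xs i)) _ ⟩
  h (lookup xs i) + (x + sum (toList xs))            ∎

-- Going through a Bool lets each decision be discarded once evaluated; `from-yes (All.all? …)`
-- keeps all their proofs alive and exhausts memory on long lists.
all-by-evaluation : ∀ {a p} {A : Set a} {P : A → Set p} (P? : ∀ x → Dec (P x)) xs →
  T (all (isYes ∘ P?) xs) → All P xs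
all-by-evaluation P? xs t = All.map (λ {x} → toWitness {a? = P? x}) (all⁺ (isYes ∘ P?) xs t)

twoRestrictedUpTo : (m b : ℕ) → List (Vec ℕ m)
twoRestrictedUpTo zero    _                   = [ [] ]
twoRestrictedUpTo (suc m) zero                = map (0 ∷_) (twoRestrictedUpTo m 0)
twoRestrictedUpTo (suc m) (suc zero)          =
  map (0 ∷_) (twoRestrictedUpTo m 1) ++ map (1 ∷_) (twoRestrictedUpTo m 0)
twoRestrictedUpTo (suc m) b@(suc b-1@(suc b-2)) =
  map (0 ∷_) (twoRestrictedUpTo m b) ++
  map (1 ∷_) (twoRestrictedUpTo m b-1) ++
  map (2 ∷_) (twoRestrictedUpTo m b-2)

∈-twoRestrictedUpTo : ∀ {m} b (f : Vec ℕ m) → (∀ u → lookup f u ≤ 2) → sum (toList f) ≤ b →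
  f ∈ twoRestrictedUpTo m b
∈-twoRestrictedUpTo b [] _ _ = here refl
∈-twoRestrictedUpTo b (x ∷ xs) f≤2 Σf≤b with f≤2 zero
∈-twoRestrictedUpTo zero (0 ∷ xs) f≤2 Σf≤b | _ =
  ∈-map⁺ (0 ∷_) (∈-twoRestrictedUpTo 0 xs (f≤2 ∘ suc) Σf≤b)
∈-twoRestrictedUpTo (suc zero) (0 ∷ xs) f≤2 Σf≤b | _ =
  ∈-++⁺ˡ (∈-map⁺ (0 ∷_) (∈-twoRestrictedUpTo 1 xs (f≤2 ∘ suc) Σf≤b))
∈-twoRestrictedUpTo (suc (suc b)) (0 ∷ xs) f≤2 Σf≤b | _ =
  ∈-++⁺ˡ (∈-map⁺ (0 ∷_) (∈-twoRestrictedUpTo (suc (suc b)) xs (f≤2 ∘ suc) Σf≤b))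
∈-twoRestrictedUpTo (suc zero) (1 ∷ xs) f≤2 (s≤s Σf≤b) | _ =
  ∈-++⁺ʳ (map (0 ∷_) (twoRestrictedUpTo _ 1))
    (∈-map⁺ (1 ∷_) (∈-twoRestrictedUpTo 0 xs (f≤2 ∘ suc) Σf≤b))
∈-twoRestrictedUpTo (suc (suc b)) (1 ∷ xs) f≤2 (s≤s Σf≤b) | _ =
  ∈-++⁺ʳ (map (0 ∷_) (twoRestrictedUpTo _ (suc (suc b))))
    (∈-++⁺ˡ (∈-map⁺ (1 ∷_) (∈-twoRestrictedUpTo (suc b) xs (f≤2 ∘ suc) Σf≤b)))
∈-twoRestrictedUpTo (suc (suc b)) (2 ∷ xs) f≤2 (s≤s (s≤s Σf≤b)) | _ =
  ∈-++⁺ʳ (map (0 ∷_) (twoRestrictedUpTo _ (suc (suc b))))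
    (∈-++⁺ʳ (map (1 ∷_) (twoRestrictedUpTo _ (suc b)))
      (∈-map⁺ (2 ∷_) (∈-twoRestrictedUpTo b xs (f≤2 ∘ suc) Σf≤b)))
∈-twoRestrictedUpTo zero (suc _ ∷ _) _ () | _
∈-twoRestrictedUpTo (suc zero) (2 ∷ _) _ (s≤s ()) | _
∈-twoRestrictedUpTo _ (suc (suc (suc _)) ∷ _) _ _ | s≤s (s≤s ())

module _ (G : Graph) where

  move : Config G → Fin (N G) → Fin (N G) → Config G
  move f u v = updateAt (updateAt f u (λ x → x ∸ 2)) v suc

  weight-move : ∀ f u v → 2 ≤ lookup f u → suc (weight G (move f u v)) ≡ weight G f
  weight-move f u v 2≤fu = trans (cong suc added) removed
    where
    f₁ = updateAt f u (λ x → x ∸ 2)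
    added : weight G (move f u v) ≡ suc (weight G f₁)
    added = +-cancelˡ-≡ (lookup f₁ v) _ _
      (trans (sum-updateAt f₁ v suc) (sym (+-suc (lookup f₁ v) (weight G f₁))))
    removed : 2 + weight G f₁ ≡ weight G f
    removed = +-cancelˡ-≡ (lookup f u ∸ 2) _ _ (begin
      (lookup f u ∸ 2) + (2 + weight G f₁) ≡⟨ sym (+-assoc (lookup f u ∸ 2) 2 _) ⟩
      (lookup f u ∸ 2 + 2) + weight G f₁   ≡⟨ cong (_+ weight G f₁) (m∸n+n≡m 2≤fu) ⟩
      lookup f u + weight G f₁             ≡⟨ sum-updateAt f u (λ x → x ∸ 2) ⟩
      (lookup f u ∸ 2) + weight G f        ∎)

  Reaches : Config G → Fin (N G) → Set
  Reaches f v = ∃[ g ] (Reach G f g × 1 ≤ lookup g v)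

  reaches-unfold : ∀ f v →
    Reaches f v ⇔
      (1 ≤ lookup f v ⊎ ∃[ u ] (2 ≤ lookup f u × ∃[ w ] (Adj G u w × Reaches (move f u w) v)))
  reaches-unfold f v = mk⇔ to from
    where
    to : Reaches f v → _
    to (_ , ε , 1≤gv) = inj₁ 1≤gv
    to (g , (u , w , adj , 2≤fu , refl) ◅ f₁↝g , 1≤gv) = inj₂ (u , 2≤fu , w , adj , g , f₁↝g , 1≤gv)
    from : _ → Reaches f v
    from (inj₁ 1≤fv) = f , ε , 1≤fv
    from (inj₂ (u , 2≤fu , w , adj , g , f₁↝g , 1≤gv)) = g , (u , w , adj , 2≤fu , refl) ◅ f₁↝g , 1≤gv

  isPi2StarCount-fromList : ∀ k f L →
    All (OptimalWith G k) (f ∷ L) →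
    All (λ g → Solvable G g → g ∈ f ∷ L) (twoRestrictedUpTo (N G) k) →
    Unique (f ∷ L) →
    IsPi2StarCount G k (length (f ∷ L))
  isPi2StarCount-fromList k f L optimal complete unique =
    ((f , All.head optimal) , lowerBound) ,
    f ∷ L , unique , refl , λ g → mk⇔ (All.lookup optimal) (listed g)
    where
    listed-below : ∀ g → SolvableTwoRPC G g → weight G g ≤ k → g ∈ f ∷ L
    listed-below g (twoRestricted , solvable) g≤k =
      All.lookup complete (∈-twoRestrictedUpTo k g twoRestricted g≤k) solvable
    lowerBound : ∀ g → SolvableTwoRPC G g → k ≤ weight G g
    lowerBound g s = ≮⇒≥ λ g<k →
      <-irrefl (proj₂ (All.lookup optimal (listed-below g s (<⇒≤ g<k)))) g<k
    listed : ∀ g → OptimalWith G k g → g ∈ f ∷ L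
    listed g (s , g≡k) = listed-below g s (≤-reflexive g≡k)

  module Decision (adj? : ∀ u v → Dec (Adj G u v)) where

    open import Data.List.Membership.DecPropositional (≡-dec {n = N G} _≟_) using (_∈?_)

    anyVertex : (Fin (N G) → Bool) → Bool
    anyVertex p = any p (allFin (N G))

    T-anyVertex : ∀ p → T (anyVertex p) ⇔ (∃[ u ] T (p u))
    T-anyVertex p = mk⇔ (satisfied ∘ any⁻ p (allFin (N G)))
      (λ (u , pu) → any⁺ {xs = allFin (N G)} p (lose (∈-allFin u) pu))

    canReachWithin : ℕ → Config G → Fin (N G) → Bool
    canReachWithin zero    f v = false
    canReachWithin (suc k) f v = (1 ≤ᵇ lookup f v) ∨ anyVertex λ u →
      (2 ≤ᵇ lookup f u) ∧ anyVertex λ w → isYes (adj? u w) ∧ canReachWithin k (move f u w) v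

    canReachWithin-sound : ∀ k f v → T (canReachWithin k f v) → Reaches f v
    canReachWithin-sound (suc k) f v reach with Equivalence.to T-∨ reach
    ... | inj₁ 1≤fv = f , ε , ≤ᵇ⇒≤ 1 _ 1≤fv
    ... | inj₂ moves =
      let u , loaded-u    = Equivalence.to (T-anyVertex _) moves
          2≤fu , moves-u  = Equivalence.to T-∧ loaded-u
          w , adj-reach   = Equivalence.to (T-anyVertex _) moves-u
          adj , reach-w   = Equivalence.to T-∧ adj-reach
      in Equivalence.from (reaches-unfold f v) (inj₂ (u , ≤ᵇ⇒≤ 2 _ 2≤fu , w , toWitness adj ,
           canReachWithin-sound k (move f u w) v reach-w))

    canReachWithin-complete : ∀ k f v → weight G f < k → Reaches f v → T (canReachWithin k f v)
    canReachWithin-complete (suc k) f v wf<k reach with Equivalence.to (reaches-unfold f v) reach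
    ... | inj₁ 1≤fv = Equivalence.from T-∨ (inj₁ (≤⇒≤ᵇ 1≤fv))
    ... | inj₂ (u , 2≤fu , w , adj , reach-w) =
      Equivalence.from T-∨ (inj₂ (Equivalence.from (T-anyVertex _) (u ,
        Equivalence.from T-∧ (≤⇒≤ᵇ 2≤fu , Equivalence.from (T-anyVertex _) (w ,
          Equivalence.from T-∧ (fromWitness adj ,
            canReachWithin-complete k (move f u w) v wg<k reach-w))))))
      where
      wg<k : weight G (move f u w) < k
      wg<k = subst (_≤ k) (sym (weight-move f u w 2≤fu)) (≤-pred wf<k)

    reaches? : ∀ f v → Dec (Reaches f v)
    reaches? f v = map′ (canReachWithin-sound k f v) (canReachWithin-complete k f v (n<1+n _))
      (T? (canReachWithin k f v))
      where k = suc (weight G f)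

    solvable? : ∀ f → Dec (Solvable G f)
    solvable? f = all? (reaches? f)

    twoRestricted? : ∀ f → Dec (TwoRestricted G f)
    twoRestricted? f = all? λ u → lookup f u ≤? 2

    optimal? : ∀ k f → Dec (OptimalWith G k f)
    optimal? k f = (twoRestricted? f ×-dec solvable? f) ×-dec weight G f ≟ k

    listedIfSolvable? : ∀ L g → Dec (Solvable G g → g ∈ L)
    listedIfSolvable? L g = solvable? g →-dec (g ∈? L)

alkEdge? : ∀ n a b → Dec (AlkEdge n a b)
alkEdge? n a b =
  (a <? n ×-dec b <? n ×-dec suc a ≟ b) ⊎-dec (a <? n ×-dec n ≤? b ×-dec owner n (b ∸ n) ≟ a)

alkaneAdj? : ∀ n (u v : Fin (N (alkane n))) → Dec (Adj (alkane n) u v)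
alkaneAdj? n u v = alkEdge? n (toℕ u) (toℕ v) ⊎-dec alkEdge? n (toℕ v) (toℕ u)

propaneOptimal : List (Config propane)
propaneOptimal =
  (1 ∷ 1 ∷ 2 ∷ 0 ∷ 0 ∷ 0 ∷ 0 ∷ 0 ∷ 0 ∷ 0 ∷ 0 ∷ []) ∷
  (1 ∷ 2 ∷ 1 ∷ 0 ∷ 0 ∷ 0 ∷ 0 ∷ 0 ∷ 0 ∷ 0 ∷ 0 ∷ []) ∷
  (2 ∷ 0 ∷ 2 ∷ 0 ∷ 0 ∷ 0 ∷ 0 ∷ 0 ∷ 0 ∷ 0 ∷ 0 ∷ []) ∷
  (2 ∷ 1 ∷ 1 ∷ 0 ∷ 0 ∷ 0 ∷ 0 ∷ 0 ∷ 0 ∷ 0 ∷ 0 ∷ []) ∷ []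

propane-pi2StarCount : IsPi2StarCount propane 4 4
propane-pi2StarCount = isPi2StarCount-fromList propane 4 _ _
  (from-yes (All.all? (optimal? 4) propaneOptimal))
  (all-by-evaluation (listedIfSolvable? propaneOptimal) (twoRestrictedUpTo 11 4) tt)
  (from-yes (unique? (≡-dec _≟_) propaneOptimal))
  where open Decision propane (alkaneAdj? 3)

butaneOptimal : List (Config butane)
butaneOptimal =
  (1 ∷ 1 ∷ 1 ∷ 2 ∷ 0 ∷ 0 ∷ 0 ∷ 0 ∷ 0 ∷ 0 ∷ 0 ∷ 0 ∷ 0 ∷ 0 ∷ []) ∷
  (1 ∷ 1 ∷ 2 ∷ 1 ∷ 0 ∷ 0 ∷ 0 ∷ 0 ∷ 0 ∷ 0 ∷ 0 ∷ 0 ∷ 0 ∷ 0 ∷ []) ∷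
  (1 ∷ 2 ∷ 0 ∷ 2 ∷ 0 ∷ 0 ∷ 0 ∷ 0 ∷ 0 ∷ 0 ∷ 0 ∷ 0 ∷ 0 ∷ 0 ∷ []) ∷
  (1 ∷ 2 ∷ 1 ∷ 1 ∷ 0 ∷ 0 ∷ 0 ∷ 0 ∷ 0 ∷ 0 ∷ 0 ∷ 0 ∷ 0 ∷ 0 ∷ []) ∷
  (2 ∷ 0 ∷ 1 ∷ 2 ∷ 0 ∷ 0 ∷ 0 ∷ 0 ∷ 0 ∷ 0 ∷ 0 ∷ 0 ∷ 0 ∷ 0 ∷ []) ∷
  (2 ∷ 0 ∷ 2 ∷ 1 ∷ 0 ∷ 0 ∷ 0 ∷ 0 ∷ 0 ∷ 0 ∷ 0 ∷ 0 ∷ 0 ∷ 0 ∷ []) ∷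
  (2 ∷ 1 ∷ 0 ∷ 2 ∷ 0 ∷ 0 ∷ 0 ∷ 0 ∷ 0 ∷ 0 ∷ 0 ∷ 0 ∷ 0 ∷ 0 ∷ []) ∷
  (2 ∷ 1 ∷ 1 ∷ 1 ∷ 0 ∷ 0 ∷ 0 ∷ 0 ∷ 0 ∷ 0 ∷ 0 ∷ 0 ∷ 0 ∷ 0 ∷ []) ∷ []

butane-pi2StarCount : IsPi2StarCount butane 5 8
butane-pi2StarCount = isPi2StarCount-fromList butane 5 _ _
  (from-yes (All.all? (optimal? 5) butaneOptimal))
  (all-by-evaluation (listedIfSolvable? butaneOptimal) (twoRestrictedUpTo 14 5) tt)
  (from-yes (unique? (≡-dec _≟_) butaneOptimal))
  where open Decision butane (alkaneAdj? 4)

mainTheorem6 : IsPi2StarCount propane 4 4 × IsPi2StarCount butane 5 8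
mainTheorem6 = propane-pi2StarCount , butane-pi2StarCount
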